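{- A permutation $\pi\in\mathbf{S}_n$ is the suffix array of some word $w\in\Sigma^n$ if and only if, for $\pi'=(n+1)\, \pi(1)\dots \pi(n)\in\mathbf{S}_{n+1}$, we have $|\{\,i\in[1,n] : \Phi(\pi')(i)>\Phi(\pi')(i+1)\,\}\setminus\{1\}|\leq k-1$.
   Context: $\Sigma=\{a_1<a_2<\dots<a_k\}$ is an ordered alphabet of size $k$. $\mathbf{S}_m$ is the set of permutations of $[1,m]$. The suffix array of a word $u=u_1\dots u_m$ is the permutation $\pi$ with $\pi(i)=j$ iff $u_j\dots u_m$ is the $i$-th suffix of $u$ in lexicographic order. For $\sigma\in\mathbf{S}_m$ the linking permutation is $\Phi(\sigma)=\sigma^{ -1}(\sigma+1)$, i.e. $\Phi(\sigma)(i)=\sigma^{ -1}(\sigma(i)+1)$ where values are taken cyclically ($m+1\equiv 1$). -}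

module Defs where

open import Data.Nat.Base as ℕ using (ℕ; zero; suc; _%_)
open import Data.Nat.DivMod using (m%n<n)
open import Data.Fin.Base using (Fin; zero; suc; toℕ; fromℕ; fromℕ<; inject₁; _<_)
open import Data.Fin.Properties using (_<?_)
open import Data.Nat.Properties using () renaming (_≟_ to _ℕ≟_)
open import Data.Fin.Permutation using (Permutation′; _⟨$⟩ʳ_; _⟨$⟩ˡ_; insert)
open import Data.Vec.Base using (Vec; toList)
open import Data.List.Base using (List; drop; filter; length; allFin)
open import Data.List.Relation.Binary.Lex.Strict using (Lex-<)
open import Relation.Binary.PropositionalEquality using (_≡_)
open import Relation.Nullary.Decidable using (_×-dec_; ¬?)

-- The ordered alphabet Σ = {a₁ < … < a_k} is modelled by Fin k with its
-- usual order; a word of length n is a Vec (Fin k) n (positions 0-indexed).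

suffix : ∀ {k n} → Vec (Fin k) n → Fin n → List (Fin k)
suffix w j = drop (toℕ j) (toList w)

-- Strict lexicographic order on words (a proper prefix is smaller).
_<lex_ : ∀ {k} → List (Fin k) → List (Fin k) → Set
_<lex_ = Lex-< _≡_ _<_

-- π is the suffix array of w: π maps rank i (0-indexed) to the starting
-- position of the i-th smallest suffix, i.e. π lists the suffixes in
-- strictly increasing lexicographic order.
IsSuffixArray : ∀ {k n} → Vec (Fin k) n → Permutation′ n → Set
IsSuffixArray {n = n} w π =
  ∀ (i j : Fin n) → i < j → suffix w (π ⟨$⟩ʳ i) <lex suffix w (π ⟨$⟩ʳ j)

-- Cyclic successor on [1,m] (m+1 ≡ 1), here on Fin m 0-indexed.
csuc : ∀ {m} → Fin m → Fin m
csuc {suc m} i = fromℕ< (m%n<n (suc (toℕ i)) (suc m))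

Φ : ∀ {m} → Permutation′ m → Fin m → Fin m
Φ σ i = σ ⟨$⟩ˡ csuc (σ ⟨$⟩ʳ i)

-- π' = (n+1) π(1) … π(n) ∈ S_{n+1}: maps the first position to the largest
-- value and position i+1 to π(i) (insert 0 ↦ last, otherwise like π).
prime : ∀ {n} → Permutation′ n → Permutation′ (suc n)
prime {n} π = insert zero (fromℕ n) π

-- |{ i ∈ [1,n] : Φ(π')(i) > Φ(π')(i+1) } ∖ {1}|.
-- 0-indexed: i ranges over Fin n, positions inject₁ i and suc i of Fin (suc n);
-- i = zero corresponds to the excluded index 1.
descentCount : ∀ {n} → Permutation′ n → ℕ
descentCount {n} π =
  length (filter (λ i → ¬? (toℕ i ℕ≟ 0) ×-dec (Φ π' (suc i) <? Φ π' (inject₁ i)))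
                 (allFin n))
  where π' = prime π

-- Prepend the empty suffix as rank 0: π′ then lists all suffixes of w by rank,
-- and Φ π′ sends the rank of a nonempty suffix to the rank of its tail. If π is
-- the suffix array of w, the first letters of the ranked suffixes weakly
-- increase, and strictly at every descent of Φ π′ counted by descentCount,
-- since there the tails are ranked in the opposite order; with k letters there
-- are at most k − 1 of them. Conversely, giving each suffix as first letter the
-- number of such descents below its rank yields a word whose suffixes with equal
-- first letters have tails ranked in the same order, so by induction on length
-- π is its suffix array.

module Submission where

open import Defs
open import Data.Nat.Base as ℕ using (ℕ; zero; suc; _≤_; _<_; _∸_; _+_; z≤n; s≤s)
open import Data.Nat.DivMod using (m<n⇒m%n≡m)
open import Data.Nat.Properties as ℕ using (module ≤-Reasoning)
open import Data.Fin.Base as Fin using (Fin; zero; suc; toℕ; fromℕ; fromℕ<; inject₁; punchIn)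
import Data.Fin.Properties as Fin
open import Data.Fin.Permutation using (Permutation′; _⟨$⟩ʳ_; _⟨$⟩ˡ_; inverseˡ; inverseʳ; insert-punchIn)
open import Data.Vec.Base using (Vec; toList; lookup; tabulate; []; _∷_)
open import Data.Vec.Properties using (length-toList; lookup∘tabulate)
open import Data.List.Base using (List; []; _∷_; [_]; _++_; drop; filter; length; allFin; map)
open import Data.List.Properties using (filter-accept; filter-reject; filter-++; length-++; map-tabulate; drop-all)
open import Data.List.Membership.Propositional using (_∈_)
open import Data.List.Membership.Propositional.Properties using (∈-allFin)
open import Data.List.Relation.Unary.Any using (here; there)
open import Data.List.Relation.Binary.Sublist.Propositional using (⊆-refl)
open import Data.List.Relation.Binary.Sublist.Propositional.Properties using (filter⁺; length-mono-≤)
open import Data.List.Relation.Binary.Lex.Strict using (<-asymmetric; halt; this; next)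
open import Data.Product.Base using (∃; _×_; _,_; proj₁)
open import Data.Sum.Base using (inj₁; inj₂)
open import Data.Empty using (⊥-elim)
open import Level using (0ℓ)
open import Function.Base using (id; _∘_)
open import Function.Bundles using (_⇔_; mk⇔)
open import Relation.Binary.Definitions using (Asymmetric)
open import Relation.Binary.PropositionalEquality
  using (_≡_; refl; sym; trans; cong; subst; subst₂; resp₂; module ≡-Reasoning)
open import Relation.Nullary using (¬_; yes; no)
open import Relation.Nullary.Decidable using (_×-dec_; ¬?)
open import Relation.Unary using (Pred; Decidable; _⊆_)

module _ {A : Set} where

  length-filter-mono : {P Q : Pred A 0ℓ} (P? : Decidable P) (Q? : Decidable Q) →
    P ⊆ Q → ∀ xs → length (filter P? xs) ≤ length (filter Q? xs)
  length-filter-mono P? Q? P⊆Q xs =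
    length-mono-≤ (filter⁺ P? Q? (λ { refl → P⊆Q }) (⊆-refl {x = xs}))

  length-filter-< : {P Q : Pred A 0ℓ} (P? : Decidable P) (Q? : Decidable Q) →
    P ⊆ Q → ∀ {y} xs → y ∈ xs → Q y → ¬ P y → length (filter P? xs) < length (filter Q? xs)
  length-filter-< P? Q? P⊆Q (x ∷ xs) (here refl) qx ¬px
    rewrite filter-reject P? {xs = xs} ¬px | filter-accept Q? {xs = xs} qx =
    s≤s (length-filter-mono P? Q? P⊆Q xs)
  length-filter-< P? Q? P⊆Q (x ∷ xs) (there y∈xs) qy ¬py with P? x | Q? x
  ... | yes px | yes _  = s≤s (length-filter-< P? Q? P⊆Q xs y∈xs qy ¬py)
  ... | yes px | no ¬qx = ⊥-elim (¬qx (P⊆Q px))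
  ... | no _   | yes _  = ℕ.m≤n⇒m≤1+n (length-filter-< P? Q? P⊆Q xs y∈xs qy ¬py)
  ... | no _   | no _   = length-filter-< P? Q? P⊆Q xs y∈xs qy ¬py

module _ {A B : Set} where

  length-filter-map : {P : Pred B 0ℓ} (P? : Decidable P) (f : A → B) → ∀ xs →
    length (filter P? (map f xs)) ≡ length (filter (P? ∘ f) xs)
  length-filter-map P? f [] = refl
  length-filter-map P? f (x ∷ xs) with P? (f x)
  ... | yes _ = cong suc (length-filter-map P? f xs)
  ... | no _  = length-filter-map P? f xs

length-filter-allFin-suc : ∀ {n} {P : Pred (Fin (suc n)) 0ℓ} (P? : Decidable P) →
  length (filter P? (allFin (suc n))) ≡ length (filter P? [ zero ]) + length (filter (P? ∘ suc) (allFin n))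
length-filter-allFin-suc {n} P? = begin
  length (filter P? (allFin (suc n)))                           ≡⟨ cong (length ∘ filter P? ∘ (zero ∷_)) (map-tabulate id suc) ⟨
  length (filter P? ([ zero ] ++ map suc (allFin n)))           ≡⟨ cong length (filter-++ P? [ zero ] _) ⟩
  length (filter P? [ zero ] ++ filter P? (map suc (allFin n))) ≡⟨ length-++ (filter P? [ zero ]) ⟩
  first + length (filter P? (map suc (allFin n)))               ≡⟨ cong (first +_) (length-filter-map P? suc (allFin n)) ⟩
  first + length (filter (P? ∘ suc) (allFin n))                 ∎
  where
  open ≡-Reasoning
  first = length (filter P? [ zero ])

ascents : ∀ {n} → (Fin (suc n) → ℕ) → ℕ
ascents {n} f = length (filter (λ i → f (inject₁ i) ℕ.<? f (suc i)) (allFin n))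

ascents+first≤last : ∀ {n} (f : Fin (suc n) → ℕ) → (∀ i → f (inject₁ i) ≤ f (suc i)) →
  ascents f + f zero ≤ f (fromℕ n)
ascents+first≤last {zero} f mono = ℕ.≤-refl
ascents+first≤last {suc n} f mono = begin
  ascents f + f zero                   ≡⟨ cong (_+ f zero) (trans (length-filter-allFin-suc Ascent?) (ℕ.+-comm first _)) ⟩
  (ascents (f ∘ suc) + first) + f zero ≡⟨ ℕ.+-assoc _ first (f zero) ⟩
  ascents (f ∘ suc) + (first + f zero) ≤⟨ ℕ.+-monoʳ-≤ _ first-step ⟩
  ascents (f ∘ suc) + f (suc zero)     ≤⟨ ascents+first≤last (f ∘ suc) (mono ∘ suc) ⟩
  f (fromℕ (suc n))                    ∎
  where
  open ≤-Reasoning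
  Ascent? = λ (i : Fin (suc n)) → f (inject₁ i) ℕ.<? f (suc i)
  first = length (filter Ascent? [ zero ])
  bounded = λ (xs : List (Fin (suc n))) → length xs + f zero ≤ f (suc zero)
  first-step : first + f zero ≤ f (suc zero)
  first-step with f zero ℕ.<? f (suc zero)
  ... | yes f₀<f₁ = subst bounded (sym (filter-accept Ascent? f₀<f₁)) f₀<f₁
  ... | no f₀≮f₁  = subst bounded (sym (filter-reject Ascent? f₀≮f₁)) (mono zero)

<-by-steps : ∀ {n} (f : Fin (suc n) → ℕ) {a b : Fin (suc n)} → a Fin.< b →
  (∀ i → a Fin.≤ inject₁ i → suc i Fin.≤ b → f (inject₁ i) < f (suc i)) → f a < f b
<-by-steps {suc n} f {zero}  {suc zero}    _         step = step zero z≤n (s≤s z≤n)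
<-by-steps {suc n} f {zero}  {suc (suc b)} _         step =
  ℕ.<-trans (step zero z≤n (s≤s z≤n))
            (<-by-steps (f ∘ suc) {zero} {suc b} (s≤s z≤n) (λ i _ i<b → step (suc i) z≤n (s≤s i<b)))
<-by-steps {suc n} f {suc a} {suc b} (s≤s a<b) step =
  <-by-steps (f ∘ suc) a<b (λ i a≤i i<b → step (suc i) (s≤s a≤i) (s≤s i<b))

headℕ : ∀ {k} → List (Fin k) → ℕ
headℕ []      = 0
headℕ (x ∷ _) = toℕ x

headℕ≤ : ∀ {k} (xs : List (Fin (suc k))) → headℕ xs ≤ k
headℕ≤ []       = z≤n
headℕ≤ (x ∷ xs) = ℕ.s≤s⁻¹ (Fin.toℕ<n x)

<lex⇒headℕ≤ : ∀ {k} {xs ys : List (Fin k)} → xs <lex ys → headℕ xs ≤ headℕ ys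
<lex⇒headℕ≤ halt          = z≤n
<lex⇒headℕ≤ (this x<y)    = ℕ.<⇒≤ x<y
<lex⇒headℕ≤ (next refl _) = ℕ.≤-refl

<lex-asym : ∀ {k} → Asymmetric (_<lex_ {k})
<lex-asym = <-asymmetric sym (resp₂ Fin._<_) Fin.<-asym

∷<lex∷⇒< : ∀ {k} {x y : Fin k} {xs ys} → (x ∷ xs) <lex (y ∷ ys) → ¬ xs <lex ys → x Fin.< y
∷<lex∷⇒< (this x<y)      _     = x<y
∷<lex∷⇒< (next _ xs<ys) xs≮ys = ⊥-elim (xs≮ys xs<ys)

drop-toList : ∀ {A : Set} {n} (w : Vec A n) (j : Fin n) →
  drop (toℕ j) (toList w) ≡ lookup w j ∷ drop (suc (toℕ j)) (toList w)
drop-toList (x ∷ w) zero    = refl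
drop-toList (x ∷ w) (suc j) = drop-toList w j

inject₁<suc : ∀ {n} (i : Fin n) → inject₁ i Fin.< suc i
inject₁<suc i = Fin.≤̄⇒inject₁< Fin.≤-refl

punchIn-fromℕ : ∀ {n} (j : Fin n) → punchIn (fromℕ n) j ≡ inject₁ j
punchIn-fromℕ zero    = refl
punchIn-fromℕ (suc j) = cong suc (punchIn-fromℕ j)

csuc-inject₁ : ∀ {n} (j : Fin n) → csuc (inject₁ j) ≡ suc j
csuc-inject₁ {n} j = Fin.toℕ-injective (begin
  toℕ (csuc (inject₁ j))          ≡⟨ Fin.toℕ-fromℕ< _ ⟩
  suc (toℕ (inject₁ j)) ℕ.% suc n ≡⟨ cong (λ m → suc m ℕ.% suc n) (Fin.toℕ-inject₁ j) ⟩
  suc (toℕ j) ℕ.% suc n           ≡⟨ m<n⇒m%n≡m (s≤s (Fin.toℕ<n j)) ⟩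
  suc (toℕ j)                     ∎)
  where open ≡-Reasoning

module _ {n} (π : Permutation′ n) where

  π′ : Permutation′ (suc n)
  π′ = prime π

  -- Rank 0 of π′ is the empty suffix (position n); rank j + 1 is position π j.
  π′-suc : ∀ j → π′ ⟨$⟩ʳ suc j ≡ inject₁ (π ⟨$⟩ʳ j)
  π′-suc j = trans (insert-punchIn zero (fromℕ n) π j) (punchIn-fromℕ _)

  π′-Φ-suc : ∀ j → π′ ⟨$⟩ʳ Φ π′ (suc j) ≡ suc (π ⟨$⟩ʳ j)
  π′-Φ-suc j = begin
    π′ ⟨$⟩ʳ (π′ ⟨$⟩ˡ csuc (π′ ⟨$⟩ʳ suc j)) ≡⟨ inverseʳ π′ ⟩
    csuc (π′ ⟨$⟩ʳ suc j)                   ≡⟨ cong csuc (π′-suc j) ⟩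
    csuc (inject₁ (π ⟨$⟩ʳ j))              ≡⟨ csuc-inject₁ _ ⟩
    suc (π ⟨$⟩ʳ j)                         ∎
    where open ≡-Reasoning

  Φ-suc-injective : ∀ {i j} → Φ π′ (suc i) ≡ Φ π′ (suc j) → i ≡ j
  Φ-suc-injective {i} {j} eq = begin
    i                  ≡⟨ inverseˡ π ⟨
    π ⟨$⟩ˡ (π ⟨$⟩ʳ i) ≡⟨ cong (π ⟨$⟩ˡ_) πi≡πj ⟩
    π ⟨$⟩ˡ (π ⟨$⟩ʳ j) ≡⟨ inverseˡ π ⟩
    j                  ∎
    where
    open ≡-Reasoning
    πi≡πj = Fin.suc-injective (trans (sym (π′-Φ-suc i)) (trans (cong (π′ ⟨$⟩ʳ_) eq) (π′-Φ-suc j)))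

  module _ {k} (w : Vec (Fin k) n) where

    suffixOfRank : Fin (suc n) → List (Fin k)
    suffixOfRank r = drop (toℕ (π′ ⟨$⟩ʳ r)) (toList w)

    suffixOfRank-zero : suffixOfRank zero ≡ []
    suffixOfRank-zero =
      drop-all _ (toList w) (ℕ.≤-reflexive (trans (length-toList w) (sym (Fin.toℕ-fromℕ n))))

    suffixOfRank-suc : ∀ j → suffixOfRank (suc j) ≡ suffix w (π ⟨$⟩ʳ j)
    suffixOfRank-suc j =
      cong (λ p → drop p (toList w)) (trans (cong toℕ (π′-suc j)) (Fin.toℕ-inject₁ _))

    suffixOfRank-∷ : ∀ j → suffixOfRank (suc j) ≡ lookup w (π ⟨$⟩ʳ j) ∷ suffixOfRank (Φ π′ (suc j))
    suffixOfRank-∷ j = begin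
      suffixOfRank (suc j)                                              ≡⟨ suffixOfRank-suc j ⟩
      drop (toℕ (π ⟨$⟩ʳ j)) (toList w)                                  ≡⟨ drop-toList w _ ⟩
      lookup w (π ⟨$⟩ʳ j) ∷ drop (toℕ (suc (π ⟨$⟩ʳ j))) (toList w)      ≡⟨ cong tail (π′-Φ-suc j) ⟨
      lookup w (π ⟨$⟩ʳ j) ∷ suffixOfRank (Φ π′ (suc j))                 ∎
      where
      open ≡-Reasoning
      tail = λ p → lookup w (π ⟨$⟩ʳ j) ∷ drop (toℕ p) (toList w)

    length-suffixOfRank-suc : ∀ j → length (suffixOfRank (suc j)) ≡ suc (length (suffixOfRank (Φ π′ (suc j))))
    length-suffixOfRank-suc j = cong length (suffixOfRank-∷ j)

    SortedByRank : Set
    SortedByRank = ∀ {a b} → a Fin.< b → suffixOfRank a <lex suffixOfRank b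

    isSuffixArray⇒sortedByRank : IsSuffixArray w π → SortedByRank
    isSuffixArray⇒sortedByRank sa {zero}  {suc b} _ =
      subst₂ _<lex_ (sym suffixOfRank-zero) (sym (suffixOfRank-∷ b)) halt
    isSuffixArray⇒sortedByRank sa {suc a} {suc b} (s≤s a<b) =
      subst₂ _<lex_ (sym (suffixOfRank-suc a)) (sym (suffixOfRank-suc b)) (sa a b a<b)

    sortedByRank⇒isSuffixArray : SortedByRank → IsSuffixArray w π
    sortedByRank⇒isSuffixArray sorted a b a<b =
      subst₂ _<lex_ (suffixOfRank-suc a) (suffixOfRank-suc b) (sorted (s≤s a<b))

  IsDescent : Pred (Fin n) 0ℓ
  IsDescent i = (¬ toℕ i ≡ 0) × (Φ π′ (suc i) Fin.< Φ π′ (inject₁ i))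

  isDescent? : Decidable IsDescent
  isDescent? i = ¬? (toℕ i ℕ.≟ 0) ×-dec (Φ π′ (suc i) Fin.<? Φ π′ (inject₁ i))

  module _ {k} (w : Vec (Fin (suc k)) n) (sorted : SortedByRank w) where

    firstLetter : Fin (suc n) → ℕ
    firstLetter r = headℕ (suffixOfRank w r)

    -- At a descent the tails are ranked in the opposite order, so the first letters must differ.
    descent⇒firstLetter< : ∀ {i} → IsDescent i → firstLetter (inject₁ i) < firstLetter (suc i)
    descent⇒firstLetter< {zero}  (i≢0 , _)            = ⊥-elim (i≢0 refl)
    descent⇒firstLetter< {suc j} (_ , tails-inverted) =
      subst₂ _<_ (cong headℕ (sym (suffixOfRank-∷ w (inject₁ j))))
                 (cong headℕ (sym (suffixOfRank-∷ w (suc j))))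
                 (∷<lex∷⇒< suffixes< (λ tails< → <lex-asym tails< (sorted tails-inverted)))
      where
      suffixes< = subst₂ _<lex_ (suffixOfRank-∷ w (inject₁ j)) (suffixOfRank-∷ w (suc j))
                         (sorted (inject₁<suc _))

    descentCount≤ : descentCount π ≤ k
    descentCount≤ = begin
      descentCount π                          ≤⟨ length-filter-mono isDescent? _ descent⇒firstLetter< (allFin n) ⟩
      ascents firstLetter                     ≤⟨ ℕ.m≤m+n _ _ ⟩
      ascents firstLetter + firstLetter zero  ≤⟨ ascents+first≤last firstLetter firstLetter-mono ⟩
      firstLetter (fromℕ n)                   ≤⟨ headℕ≤ (suffixOfRank w (fromℕ n)) ⟩
      k                                       ∎
      where
      open ≤-Reasoning
      firstLetter-mono = λ i → <lex⇒headℕ≤ (sorted (inject₁<suc _))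

  module _ {k} (few : descentCount π ≤ k) where

    descentsBelow : Fin (suc n) → ℕ
    descentsBelow r = length (filter (λ i → isDescent? i ×-dec (toℕ i ℕ.<? toℕ r)) (allFin n))

    descentsBelow≤k : ∀ r → descentsBelow r ≤ k
    descentsBelow≤k r = ℕ.≤-trans (length-filter-mono _ isDescent? proj₁ (allFin n)) few

    descentsBelow-mono : ∀ {a b} → a Fin.≤ b → descentsBelow a ≤ descentsBelow b
    descentsBelow-mono a≤b =
      length-filter-mono _ _ (λ (d , i<a) → d , ℕ.<-≤-trans i<a a≤b) (allFin n)

    descentsBelow-< : ∀ {a b} i → IsDescent i → a Fin.≤ inject₁ i → suc i Fin.≤ b →
      descentsBelow a < descentsBelow b
    descentsBelow-< {a} {b} i d a≤i i<b =
      length-filter-< _ _ (λ (d , i<a) → d , ℕ.<-trans i<a a<b) (allFin n) (∈-allFin i) (d , i<b)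
        (λ (_ , i<a) → ℕ.<-irrefl refl (ℕ.<-≤-trans i<a a≤i′))
      where
      a≤i′ = subst (toℕ a ≤_) (Fin.toℕ-inject₁ i) a≤i
      a<b  = ℕ.≤-<-trans a≤i′ i<b

    word : Vec (Fin (suc k)) n
    word = tabulate (λ p → fromℕ< (s≤s (descentsBelow≤k (suc (π ⟨$⟩ˡ p)))))

    toℕ-word : ∀ j → toℕ (lookup word (π ⟨$⟩ʳ j)) ≡ descentsBelow (suc j)
    toℕ-word j = begin
      toℕ (lookup word (π ⟨$⟩ʳ j))              ≡⟨ cong toℕ (lookup∘tabulate _ (π ⟨$⟩ʳ j)) ⟩
      toℕ (fromℕ< _)                            ≡⟨ Fin.toℕ-fromℕ< _ ⟩
      descentsBelow (suc (π ⟨$⟩ˡ (π ⟨$⟩ʳ j)))   ≡⟨ cong (descentsBelow ∘ suc) (inverseˡ π) ⟩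
      descentsBelow (suc j)                     ∎
      where open ≡-Reasoning

    -- With no descent between the ranks of two suffixes, Φ π′ increases step by step from one to the other.
    tails-ordered : ∀ {a b} → a Fin.< b → descentsBelow (suc a) ≡ descentsBelow (suc b) →
      Φ π′ (suc a) Fin.< Φ π′ (suc b)
    tails-ordered {a} {b} a<b same = <-by-steps (toℕ ∘ Φ π′) (s≤s a<b) step
      where
      step : ∀ i → suc a Fin.≤ inject₁ i → suc i Fin.≤ suc b → Φ π′ (inject₁ i) Fin.< Φ π′ (suc i)
      step (suc i) a≤i i<b = ℕ.≤∧≢⇒< (ℕ.≮⇒≥ not-descent) (distinct ∘ Fin.toℕ-injective)
        where
        not-descent = λ desc → ℕ.<-irrefl same (descentsBelow-< (suc i) ((λ ()) , desc) a≤i i<b)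
        distinct = λ eq → Fin.<⇒≢ (inject₁<suc _) (Φ-suc-injective eq)

    word-sorted : SortedByRank word
    word-sorted {a} = sorted-up-to (length (suffixOfRank word a)) refl
      where
      S = suffixOfRank word

      sorted-up-to : ∀ m {a b} → length (S a) ≡ m → a Fin.< b → S a <lex S b
      sorted-up-to m {zero} {suc b} _ _ =
        subst₂ _<lex_ (sym (suffixOfRank-zero word)) (sym (suffixOfRank-∷ word b)) halt
      sorted-up-to zero {suc a} len _ = ⊥-elim (ℕ.1+n≢0 (trans (sym (length-suffixOfRank-suc word a)) len))
      sorted-up-to (suc m) {suc a} {suc b} len (s≤s a<b) =
        subst₂ _<lex_ (sym (suffixOfRank-∷ word a)) (sym (suffixOfRank-∷ word b)) cons<cons
        where
        tail-len = ℕ.suc-injective (trans (sym (length-suffixOfRank-suc word a)) len)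
        cons<cons : (lookup word (π ⟨$⟩ʳ a) ∷ S (Φ π′ (suc a))) <lex (lookup word (π ⟨$⟩ʳ b) ∷ S (Φ π′ (suc b)))
        cons<cons with ℕ.m≤n⇒m<n∨m≡n (descentsBelow-mono {suc a} {suc b} (ℕ.<⇒≤ (s≤s a<b)))
        ... | inj₁ below< = this (subst₂ _<_ (sym (toℕ-word a)) (sym (toℕ-word b)) below<)
        ... | inj₂ same   = next (Fin.toℕ-injective (trans (toℕ-word a) (trans same (sym (toℕ-word b)))))
                                 (sorted-up-to m tail-len (tails-ordered a<b same))

mainTheorem7 : (k : ℕ) → 1 ≤ k → (n : ℕ) → (π : Permutation′ n) →
    (∃ λ (w : Vec (Fin k) n) → IsSuffixArray w π) ⇔ (descentCount π ≤ k ∸ 1)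
mainTheorem7 (suc k) _ n π = mk⇔
  (λ (w , isSA) → descentCount≤ π w (isSuffixArray⇒sortedByRank π w isSA))
  (λ few → word π few , sortedByRank⇒isSuffixArray π (word π few) (word-sorted π few))
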